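{- Let $\mathcal{F} \subseteq \mathcal{P}([n])$ be subset-closed, $a \in [n]$, and $A \subseteq [n] \setminus \{a\}$. Then \[ \Lambda(\mathcal{F})_{(A, A \cup \{a\})} = \sum_{B \in A \oplus \rho(\{\emptyset\})} |B|!\,(n-1-|B|)!, \] where $\rho(\{\emptyset\}) = \{ C \subseteq [n]\setminus\{a\} : C \in \mathcal{F},\ C \cup \{a\} \notin \mathcal{F}\}$ and $A \oplus \mathcal{C} = \{A \oplus C : C \in \mathcal{C}\}$.
   Context: $[n] = \{1,\dots,n\}$, $\mathcal{P}([n])$ is the power set, $\oplus$ is symmetric difference; a family is subset-closed if it contains all subsets of its members. (The factor $(n-1-|B|)!$ is $|B^c|!$ with the complement taken in $[n]\setminus\{a\}$.) Let $\Sigma$ be the set of permutations of $[n]$. For $\sigma \in \Sigma$ and $X \subseteq [n]$ define the path $P^{\sigma,X}_0 = X$, $P^{\sigma,X}_k = P^{\sigma,X}_{k-1} \oplus \{\sigma(k)\}$ for $k \in [n]$. With $(e_{(Y,Z)})$ the standard basis of $\mathbb{R}^{\mathcal{P}([n])\times\mathcal{P}([n])}$, define \[ \Lambda(\mathcal{F}) = \sum_{\sigma \in \Sigma} \sum_{X \in \mathcal{F}} \sum_{k \in [n]} \left( e_{(P^{\sigma,X}_{k-1}, P^{\sigma,X}_k)} - e_{(P^{\sigma,X}_k, P^{\sigma,X}_{k-1})} \right). \] -}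

module Defs where

open import Data.Bool using (Bool; true; false; _∧_; _∨_; not; _xor_; if_then_else_)
open import Data.Nat using (ℕ; zero; suc; _∸_)
import Data.Nat
open import Data.Nat using (_!)
open import Data.Fin using (Fin)
open import Data.Fin.Subset using (Subset; ⁅_⁆; _⊆_; ∣_∣)
open import Data.Fin.Properties as FinP using ()
open import Data.List using (List; []; _∷_; map; concatMap; filter; foldr; allFin)
open import Data.Bool.ListAction using (any)
open import Data.Vec using (Vec; []; _∷_; zipWith; toList; lookup)
open import Data.Vec.Properties using (≡-dec)
open import Data.Integer using (ℤ; +_; _+_; _-_)
open import Data.Product using (_×_; _,_)
open import Relation.Binary.PropositionalEquality using (_≡_)
open import Relation.Nullary.Decidable using (⌊_⌋)
import Data.Bool.Properties as BoolP

Family : ℕ → Set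
Family n = Subset n → Bool

SubsetClosed : ∀ {n} → Family n → Set
SubsetClosed {n} F = ∀ (X Y : Subset n) → Y ⊆ X → F X ≡ true → F Y ≡ true

_⊕_ : ∀ {n} → Subset n → Subset n → Subset n
_⊕_ = zipWith _xor_

_==_ : ∀ {n} → Subset n → Subset n → Bool
X == Y = ⌊ ≡-dec BoolP._≟_ X Y ⌋

allSubsets : (n : ℕ) → List (Subset n)
allSubsets zero = [] ∷ []
allSubsets (suc n) = concatMap (λ X → (false ∷ X) ∷ (true ∷ X) ∷ []) (allSubsets n)

allVecs : (n m : ℕ) → List (Vec (Fin n) m)
allVecs n zero = [] ∷ []
allVecs n (suc m) = concatMap (λ i → map (i ∷_) (allVecs n m)) (allFin n)

distinct : ∀ {n} → List (Fin n) → Bool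
distinct [] = true
distinct (x ∷ xs) = not (any (λ y → ⌊ x FinP.≟ y ⌋) xs) ∧ distinct xs

-- Σ = all permutations σ of [n], given as the sequence (σ(1), …, σ(n))
allPerms : (n : ℕ) → List (Vec (Fin n) n)
allPerms n = filter (λ σ → distinct (toList σ) BoolP.≟ true) (allVecs n n)

pathSteps : ∀ {n} → Subset n → List (Fin n) → List (Subset n × Subset n)
pathSteps X [] = []
pathSteps X (s ∷ ss) = (X , X ⊕ ⁅ s ⁆) ∷ pathSteps (X ⊕ ⁅ s ⁆) ss

sumℤ : List ℤ → ℤ
sumℤ = foldr _+_ (+ 0)

sumℕ : List ℕ → ℕ
sumℕ = foldr Data.Nat._+_ 0

indicator : Bool → ℤ
indicator b = if b then + 1 else + 0

-- contribution of e_{(U,V)} - e_{(V,U)} to the (Y,Z) coordinate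
edgeCoord : ∀ {n} → Subset n → Subset n → Subset n × Subset n → ℤ
edgeCoord Y Z (U , V) = indicator ((U == Y) ∧ (V == Z)) - indicator ((V == Y) ∧ (U == Z))

Λ : ∀ {n} → Family n → Subset n → Subset n → ℤ
Λ {n} F Y Z =
  sumℤ (map (λ σ →
    sumℤ (map (λ X →
      sumℤ (map (edgeCoord Y Z) (pathSteps X (toList σ))))
      (filter (λ X → F X BoolP.≟ true) (allSubsets n))))
    (allPerms n))

ρ : ∀ {n} → Family n → Fin n → Subset n → Bool
ρ F a C = not (lookup C a) ∧ F C ∧ not (F (C Data.Fin.Subset.∪ ⁅ a ⁆))

inXorFamily : ∀ {n} → Subset n → (Subset n → Bool) → Subset n → Bool
inXorFamily {n} A 𝒞 B = any (λ C → 𝒞 C ∧ (B == (A ⊕ C))) (allSubsets n)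

rhs : ∀ {n} → Family n → Fin n → Subset n → ℕ
rhs {n} F a A =
  sumℕ (map (λ B → (∣ B ∣ !) Data.Nat.* ((n ∸ 1 ∸ ∣ B ∣) !))
    (filter (λ B → inXorFamily A (ρ F a) B BoolP.≟ true) (allSubsets n)))

-- Along a permutation σ every coordinate is flipped exactly once, so a path P^{σ,X} uses an edge
-- between A and A ∪ {a} only at the step k with σ(k) = a, where it sits at X ⊕ B with B the set of
-- entries preceding a in σ: it traverses (A, A ∪ {a}) when X = A ⊕ B and the reverse edge when
-- X = (A ⊕ B) ∪ {a}. Summing over X ∈ F, the permutation σ contributes
-- [A ⊕ B ∈ F] − [(A ⊕ B) ∪ {a} ∈ F], which for subset-closed F is [A ⊕ B ∈ ρ({∅})]. Finally,
-- exactly |B|! (n − 1 − |B|)! permutations have B as the set of entries preceding a; this count is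
-- proved by induction over injective sequences avoiding a growing set K of used entries.

module Submission where

open import Defs
open import Data.Bool using (Bool; true; false; _∧_; _∨_; not; _xor_; if_then_else_)
open import Data.Bool.ListAction using (any; or)
import Data.Bool.Properties as Bool
open import Data.Nat using (ℕ; zero; suc; _+_; _*_; _∸_; _!; pred)
open import Data.Nat.Tactic.RingSolver using (solve-∀)
open import Data.Nat.Properties hiding (_≟_)
open import Data.Nat.ListAction.Properties using (sum-++)
open import Data.List using (List; []; _∷_; map; concatMap; filter; _++_; allFin)
open import Data.List.Properties using (map-++; map-cong; map-∘; map-tabulate)
open import Data.Integer as ℤ using (ℤ; _-_; _⊖_) renaming (+_ to pos; _+_ to _+ℤ_)
import Data.Integer.Properties as ℤ
import Data.Integer.Tactic.RingSolver as ℤ-Solver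
open import Algebra.Properties.CommutativeSemigroup +-commutativeSemigroup using (interchange)
import Algebra.Properties.CommutativeSemigroup *-commutativeSemigroup as *-Props
open import Algebra.Bundles using (CommutativeMonoid)
import Algebra.Properties.CommutativeSemigroup
  (CommutativeMonoid.commutativeSemigroup Bool.∧-commutativeMonoid) as ∧-Props
open import Data.Fin using (Fin; zero; suc)
open import Data.Fin.Properties using (_≟_)
open import Data.Fin.Subset using (Subset; ⊥; ⁅_⁆; _∪_; ∁; ∣_∣; _∉_)
open import Data.Fin.Subset.Properties
  using (∪-identityʳ; p⊆p∪q; ∣∁p∣≡n∸∣p∣; ∣⁅x⁆∣≡1; ∣⊥∣≡0; ∣p∣≡n⇒p≡⊤)
open import Data.Vec using ([]; _∷_; lookup; zipWith; toList)
open import Data.Vec.Properties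
  using (≡-dec; ∷-injectiveˡ; ∷-injectiveʳ; lookup-map; lookup⇒[]=; lookup-zipWith; lookup-replicate;
         zipWith-assoc; zipWith-comm; zipWith-identityʳ)
open import Function using (_∘_)
open import Data.Product using (_×_; _,_)
open import Function.Bundles using (_⇔_; mk⇔)
open import Relation.Nullary using (Dec; yes; no; contradiction)
open import Relation.Nullary.Decidable using (⌊_⌋; dec-false; does-⇔; isYes≗does; ⌊⌋-map′)
open import Relation.Binary.PropositionalEquality

variable
  A B : Set
  n : ℕ

-- Indicators and finite sums

𝟙 : Bool → ℕ
𝟙 true = 1
𝟙 false = 0

𝟙-∧ : ∀ b c → 𝟙 (b ∧ c) ≡ 𝟙 b * 𝟙 c
𝟙-∧ true c = sym (+-identityʳ (𝟙 c))
𝟙-∧ false c = refl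

𝟙-*-cong : {b : Bool} {x y : ℕ} → (b ≡ true → x ≡ y) → 𝟙 b * x ≡ 𝟙 b * y
𝟙-*-cong {false} _ = refl
𝟙-*-cong {true} x≡y = cong (1 *_) (x≡y refl)

indicator≡+𝟙 : ∀ b → indicator b ≡ pos (𝟙 b)
indicator≡+𝟙 true = refl
indicator≡+𝟙 false = refl

∑ : List A → (A → ℕ) → ℕ
∑ xs f = sumℕ (map f xs)

infix 5 ∑
syntax ∑ xs (λ x → e) = ∑[ x ∈ xs ] e

∑ℤ : List A → (A → ℤ) → ℤ
∑ℤ xs f = sumℤ (map f xs)

infix 5 ∑ℤ
syntax ∑ℤ xs (λ x → e) = ∑ℤ[ x ∈ xs ] e


∑-cong : (xs : List A) {f g : A → ℕ} → (∀ x → f x ≡ g x) → ∑ xs f ≡ ∑ xs g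
∑-cong xs f≗g = cong sumℕ (map-cong f≗g xs)

∑-++ : (xs ys : List A) (f : A → ℕ) → ∑ (xs ++ ys) f ≡ ∑ xs f + ∑ ys f
∑-++ xs ys f = trans (cong sumℕ (map-++ f xs ys)) (sum-++ (map f xs) (map f ys))

∑-map : (g : A → B) (xs : List A) (f : B → ℕ) → ∑ (map g xs) f ≡ ∑[ x ∈ xs ] f (g x)
∑-map g xs f = cong sumℕ (sym (map-∘ xs))

∑-concatMap : (g : A → List B) (xs : List A) (f : B → ℕ) →
              ∑ (concatMap g xs) f ≡ ∑[ x ∈ xs ] ∑ (g x) f
∑-concatMap g [] f = refl
∑-concatMap g (x ∷ xs) f = trans (∑-++ (g x) (concatMap g xs) f) (cong (∑ (g x) f +_) (∑-concatMap g xs f))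

∑-+ : (xs : List A) (f g : A → ℕ) → ∑[ x ∈ xs ] (f x + g x) ≡ ∑ xs f + ∑ xs g
∑-+ [] f g = refl
∑-+ (x ∷ xs) f g = trans (cong (f x + g x +_) (∑-+ xs f g)) (interchange (f x) (g x) (∑ xs f) (∑ xs g))

∑-*ˡ : (xs : List A) (c : ℕ) (f : A → ℕ) → ∑[ x ∈ xs ] (c * f x) ≡ c * ∑ xs f
∑-*ˡ [] c f = sym (*-zeroʳ c)
∑-*ˡ (x ∷ xs) c f = trans (cong (c * f x +_) (∑-*ˡ xs c f)) (sym (*-distribˡ-+ c (f x) (∑ xs f)))

∑-*ʳ : (xs : List A) (c : ℕ) (f : A → ℕ) → ∑[ x ∈ xs ] (f x * c) ≡ ∑ xs f * c
∑-*ʳ xs c f = trans (∑-cong xs (λ x → *-comm (f x) c)) (trans (∑-*ˡ xs c f) (*-comm c (∑ xs f)))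

∑-zero : (xs : List A) → ∑[ x ∈ xs ] 0 ≡ 0
∑-zero [] = refl
∑-zero (x ∷ xs) = ∑-zero xs

∑-comm : (xs : List A) (ys : List B) (f : A → B → ℕ) →
         ∑[ x ∈ xs ] ∑[ y ∈ ys ] f x y ≡ ∑[ y ∈ ys ] ∑[ x ∈ xs ] f x y
∑-comm [] ys f = sym (∑-zero ys)
∑-comm (x ∷ xs) ys f = trans (cong (∑ ys (f x) +_) (∑-comm xs ys f)) (sym (∑-+ ys (f x) _))

∑-filter : (p : A → Bool) (xs : List A) (f : A → ℕ) →
           ∑ (filter (λ x → p x Bool.≟ true) xs) f ≡ ∑[ x ∈ xs ] 𝟙 (p x) * f x
∑-filter p [] f = refl
∑-filter p (x ∷ xs) f with p x
... | true = cong₂ _+_ (sym (+-identityʳ (f x))) (∑-filter p xs f)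
... | false = ∑-filter p xs f

∑ℤ-cong : (xs : List A) {f g : A → ℤ} → (∀ x → f x ≡ g x) → ∑ℤ xs f ≡ ∑ℤ xs g
∑ℤ-cong xs f≗g = cong sumℤ (map-cong f≗g xs)

∑ℤ-filter : (p : A → Bool) (xs : List A) (f : A → ℤ) →
            ∑ℤ (filter (λ x → p x Bool.≟ true) xs) f ≡ ∑ℤ[ x ∈ xs ] (if p x then f x else pos 0)
∑ℤ-filter p [] f = refl
∑ℤ-filter p (x ∷ xs) f with p x
... | true = cong (f x +ℤ_) (∑ℤ-filter p xs f)
... | false = trans (∑ℤ-filter p xs f) (sym (ℤ.+-identityˡ _))

∑ℤ-pos : (xs : List A) (f : A → ℕ) → ∑ℤ[ x ∈ xs ] pos (f x) ≡ pos (∑ xs f)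
∑ℤ-pos [] f = refl
∑ℤ-pos (x ∷ xs) f = trans (cong (pos (f x) +ℤ_) (∑ℤ-pos xs f)) (sym (ℤ.pos-+ (f x) (∑ xs f)))

∑ℤ-pos-minus : (xs : List A) (f g : A → ℕ) →
       ∑ℤ[ x ∈ xs ] (pos (f x) - pos (g x)) ≡ pos (∑ xs f) - pos (∑ xs g)
∑ℤ-pos-minus [] f g = refl
∑ℤ-pos-minus (x ∷ xs) f g = begin
  (pos (f x) - pos (g x)) +ℤ (∑ℤ[ y ∈ xs ] (pos (f y) - pos (g y)))
    ≡⟨ cong ((pos (f x) - pos (g x)) +ℤ_) (∑ℤ-pos-minus xs f g) ⟩
  (pos (f x) - pos (g x)) +ℤ (pos (∑ xs f) - pos (∑ xs g))
    ≡⟨ minus-interchange (pos (f x)) (pos (g x)) (pos (∑ xs f)) (pos (∑ xs g)) ⟩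
  (pos (f x) +ℤ pos (∑ xs f)) - (pos (g x) +ℤ pos (∑ xs g))
    ≡⟨ sym (cong₂ _-_ (ℤ.pos-+ (f x) (∑ xs f)) (ℤ.pos-+ (g x) (∑ xs g))) ⟩
  pos (f x + ∑ xs f) - pos (g x + ∑ xs g) ∎
  where
  open ≡-Reasoning
  minus-interchange : ∀ a b c d → (a - b) +ℤ (c - d) ≡ (a +ℤ c) - (b +ℤ d)
  minus-interchange = ℤ-Solver.solve-∀

-- Subsets as Boolean vectors

∧-congˡ-true : ∀ {b c d} → (b ≡ true → c ≡ d) → b ∧ c ≡ b ∧ d
∧-congˡ-true {false} c≡d = refl
∧-congˡ-true {true} c≡d = c≡d refl

==-⇔ : {X Y : Subset n} {P : Set} → X ≡ Y ⇔ P → (P? : Dec P) → (X == Y) ≡ ⌊ P? ⌋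
==-⇔ {X = X} {Y} X≡Y⇔P P? =
  trans (isYes≗does X≟Y) (trans (does-⇔ X≡Y⇔P X≟Y P?) (sym (isYes≗does P?)))
  where X≟Y = ≡-dec Bool._≟_ X Y

==-sound : {X Y : Subset n} → (X == Y) ≡ true → X ≡ Y
==-sound {X = X} {Y} eq with ≡-dec Bool._≟_ X Y
... | yes X≡Y = X≡Y

==-refl : (X : Subset n) → (X == X) ≡ true
==-refl X with ≡-dec Bool._≟_ X X
... | yes _ = refl
... | no X≢X = contradiction refl X≢X

==-refute : {X Y : Subset n} → X ≢ Y → (X == Y) ≡ false
==-refute {X = X} {Y} X≢Y with ≡-dec Bool._≟_ X Y
... | yes X≡Y = contradiction X≡Y X≢Y
... | no _ = refl

∷-==-∷ : (x : Bool) (X Z : Subset n) → ((x ∷ X) == (x ∷ Z)) ≡ (X == Z)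
∷-==-∷ x X Z = ==-⇔ (mk⇔ ∷-injectiveʳ (cong (x ∷_))) (≡-dec Bool._≟_ X Z)

∷-==-∷-≢ : {x z : Bool} (X Z : Subset n) → x ≢ z → ((x ∷ X) == (z ∷ Z)) ≡ false
∷-==-∷-≢ X Z x≢z = ==-refute (x≢z ∘ ∷-injectiveˡ)

lookup-⊕ : (X Y : Subset n) (i : Fin n) → lookup (X ⊕ Y) i ≡ lookup X i xor lookup Y i
lookup-⊕ X Y i = lookup-zipWith _xor_ i X Y

lookup-∪ : (X Y : Subset n) (i : Fin n) → lookup (X ∪ Y) i ≡ lookup X i ∨ lookup Y i
lookup-∪ X Y i = lookup-zipWith _∨_ i X Y

lookup-⁅⁆ : (i j : Fin n) → lookup ⁅ i ⁆ j ≡ ⌊ i ≟ j ⌋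
lookup-⁅⁆ zero zero = refl
lookup-⁅⁆ zero (suc j) = lookup-replicate j false
lookup-⁅⁆ (suc i) zero = refl
lookup-⁅⁆ (suc i) (suc j) = trans (lookup-⁅⁆ i j) (sym (⌊⌋-map′ _ _ (i ≟ j)))

lookup-⁅i⁆-i : (i : Fin n) → lookup ⁅ i ⁆ i ≡ true
lookup-⁅i⁆-i zero = refl
lookup-⁅i⁆-i (suc i) = lookup-⁅i⁆-i i

lookup-⁅⁆-≢ : {i j : Fin n} → i ≢ j → lookup ⁅ i ⁆ j ≡ false
lookup-⁅⁆-≢ {i = i} {j} i≢j = trans (lookup-⁅⁆ i j) (trans (isYes≗does (i ≟ j)) (dec-false (i ≟ j) i≢j))

⁅⁆-injective : {i j : Fin n} → ⁅ i ⁆ ≡ ⁅ j ⁆ → i ≡ j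
⁅⁆-injective {i = zero} {zero} eq = refl
⁅⁆-injective {i = suc i} {suc j} eq = cong suc (⁅⁆-injective (∷-injectiveʳ eq))

⊕-assoc : (X Y Z : Subset n) → (X ⊕ Y) ⊕ Z ≡ X ⊕ (Y ⊕ Z)
⊕-assoc = zipWith-assoc Bool.xor-assoc

⊕-comm : (X Y : Subset n) → X ⊕ Y ≡ Y ⊕ X
⊕-comm = zipWith-comm Bool.xor-comm

⊕-identityʳ : (X : Subset n) → X ⊕ ⊥ ≡ X
⊕-identityʳ = zipWith-identityʳ Bool.xor-identityʳ

⊕-cancelˡ : (X Y : Subset n) → X ⊕ (X ⊕ Y) ≡ Y
⊕-cancelˡ [] [] = refl
⊕-cancelˡ (false ∷ X) (y ∷ Y) = cong (y ∷_) (⊕-cancelˡ X Y)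
⊕-cancelˡ (true ∷ X) (y ∷ Y) = cong₂ _∷_ (Bool.not-involutive y) (⊕-cancelˡ X Y)

⊕-cancelʳ : (X Y : Subset n) → (X ⊕ Y) ⊕ Y ≡ X
⊕-cancelʳ X Y = trans (⊕-comm (X ⊕ Y) Y) (trans (cong (Y ⊕_) (⊕-comm X Y)) (⊕-cancelˡ Y X))

⊕-injectiveˡ : (X : Subset n) {Y Z : Subset n} → X ⊕ Y ≡ X ⊕ Z → Y ≡ Z
⊕-injectiveˡ X {Y} {Z} eq = trans (sym (⊕-cancelˡ X Y)) (trans (cong (X ⊕_) eq) (⊕-cancelˡ X Z))

⊕-==ˡ : (X S W : Subset n) → ((X ⊕ S) == W) ≡ (X == (W ⊕ S))
⊕-==ˡ X S W = ==-⇔ (mk⇔ (λ eq → trans (sym (⊕-cancelʳ X S)) (cong (_⊕ S) eq))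
                        (λ eq → trans (cong (_⊕ S) eq) (⊕-cancelʳ W S)))
                   (≡-dec Bool._≟_ X (W ⊕ S))

⊕⁅⁆≡∪⁅⁆ : (X : Subset n) (i : Fin n) → lookup X i ≡ false → X ⊕ ⁅ i ⁆ ≡ X ∪ ⁅ i ⁆
⊕⁅⁆≡∪⁅⁆ (false ∷ X) zero _ = cong (true ∷_) (trans (⊕-identityʳ X) (sym (∪-identityʳ X)))
⊕⁅⁆≡∪⁅⁆ (x ∷ X) (suc i) i∉X =
  cong₂ _∷_ (trans (Bool.xor-identityʳ x) (sym (Bool.∨-identityʳ x))) (⊕⁅⁆≡∪⁅⁆ X i i∉X)

∣p∪⁅i⁆∣ : (p : Subset n) (i : Fin n) → lookup p i ≡ false → ∣ p ∪ ⁅ i ⁆ ∣ ≡ suc ∣ p ∣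
∣p∪⁅i⁆∣ (false ∷ p) zero _ = cong (suc ∘ ∣_∣) (∪-identityʳ p)
∣p∪⁅i⁆∣ (true ∷ p) (suc i) i∉p = cong suc (∣p∪⁅i⁆∣ p i i∉p)
∣p∪⁅i⁆∣ (false ∷ p) (suc i) i∉p = ∣p∪⁅i⁆∣ p i i∉p

∣p⊕⁅i⁆∣ : (p : Subset n) (i : Fin n) → lookup p i ≡ true → suc ∣ p ⊕ ⁅ i ⁆ ∣ ≡ ∣ p ∣
∣p⊕⁅i⁆∣ (true ∷ p) zero _ = cong (suc ∘ ∣_∣) (⊕-identityʳ p)
∣p⊕⁅i⁆∣ (true ∷ p) (suc i) i∈p = cong suc (∣p⊕⁅i⁆∣ p i i∈p)
∣p⊕⁅i⁆∣ (false ∷ p) (suc i) i∈p = ∣p⊕⁅i⁆∣ p i i∈p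

∣p∣≡0⇒p≡⊥ : (p : Subset n) → ∣ p ∣ ≡ 0 → p ≡ ⊥
∣p∣≡0⇒p≡⊥ [] _ = refl
∣p∣≡0⇒p≡⊥ (false ∷ p) ∣p∣≡0 = cong (false ∷_) (∣p∣≡0⇒p≡⊥ p ∣p∣≡0)

∣p∣≡1+k⇒p≢⊥ : (p : Subset n) {k : ℕ} → ∣ p ∣ ≡ suc k → p ≢ ⊥
∣p∣≡1+k⇒p≢⊥ {n} p ∣p∣≡1+k refl = 0≢1+n (trans (sym (∣⊥∣≡0 n)) ∣p∣≡1+k)

∑-allSubsets-δ : (Z : Subset n) (g : Subset n → ℕ) → ∑[ X ∈ allSubsets n ] 𝟙 (X == Z) * g X ≡ g Z
∑-allSubsets-δ [] g = trans (+-identityʳ _) (*-identityˡ (g []))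
∑-allSubsets-δ {suc n} (z ∷ Z) g = begin
  ∑ (allSubsets (suc n)) h
    ≡⟨ ∑-concatMap (λ X → (false ∷ X) ∷ (true ∷ X) ∷ []) (allSubsets n) h ⟩
  ∑[ X ∈ allSubsets n ] (h (false ∷ X) + (h (true ∷ X) + 0))
    ≡⟨ ∑-cong (allSubsets n) (split z) ⟩
  ∑[ X ∈ allSubsets n ] 𝟙 (X == Z) * g (z ∷ X)
    ≡⟨ ∑-allSubsets-δ Z (g ∘ (z ∷_)) ⟩
  g (z ∷ Z) ∎
  where
  open ≡-Reasoning
  h : Subset (suc n) → ℕ
  h X = 𝟙 (X == (z ∷ Z)) * g X
  split : ∀ z X → 𝟙 ((false ∷ X) == (z ∷ Z)) * g (false ∷ X) + (𝟙 ((true ∷ X) == (z ∷ Z)) * g (true ∷ X) + 0)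
                ≡ 𝟙 (X == Z) * g (z ∷ X)
  split false X rewrite ∷-==-∷ false X Z | ∷-==-∷-≢ {x = true} {z = false} X Z (λ ()) = +-identityʳ _
  split true X rewrite ∷-==-∷ true X Z | ∷-==-∷-≢ {x = false} {z = true} X Z (λ ()) = +-identityʳ _

∑-allSubsets-δ-∧ : (P : Subset n → Bool) (h : Bool) (W : Subset n) →
                   ∑[ X ∈ allSubsets n ] 𝟙 (P X) * 𝟙 (h ∧ (X == W)) ≡ 𝟙 h * 𝟙 (P W)
∑-allSubsets-δ-∧ {n} P h W = trans (∑-cong (allSubsets n) reorder) (∑-allSubsets-δ W (λ X → 𝟙 h * 𝟙 (P X)))
  where
  reorder : ∀ X → 𝟙 (P X) * 𝟙 (h ∧ (X == W)) ≡ 𝟙 (X == W) * (𝟙 h * 𝟙 (P X))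
  reorder X rewrite 𝟙-∧ h (X == W) = *-Props.x∙yz≈z∙yx (𝟙 (P X)) (𝟙 h) (𝟙 (X == W))

any-allSubsets-δ : (P : Subset n → Bool) (Z : Subset n) → any (λ C → P C ∧ (C == Z)) (allSubsets n) ≡ P Z
any-allSubsets-δ P [] = trans (Bool.∨-identityʳ _) (Bool.∧-identityʳ (P []))
any-allSubsets-δ {suc n} P (z ∷ Z) = trans (pairs z (allSubsets n)) (any-allSubsets-δ (P ∘ (z ∷_)) Z)
  where
  pairs : ∀ z Xs → any (λ C → P C ∧ (C == (z ∷ Z))) (concatMap (λ X → (false ∷ X) ∷ (true ∷ X) ∷ []) Xs)
                   ≡ any (λ X → P (z ∷ X) ∧ (X == Z)) Xs
  pairs z [] = refl
  pairs false (X ∷ Xs) rewrite ∷-==-∷ false X Z | ∷-==-∷-≢ {x = true} {z = false} X Z (λ ()) | Bool.∧-zeroʳ (P (true ∷ X)) =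
    cong (P (false ∷ X) ∧ (X == Z) ∨_) (pairs false Xs)
  pairs true (X ∷ Xs) rewrite ∷-==-∷ true X Z | ∷-==-∷-≢ {x = false} {z = true} X Z (λ ()) | Bool.∧-zeroʳ (P (false ∷ X)) =
    cong (P (true ∷ X) ∧ (X == Z) ∨_) (pairs true Xs)

inXorFamily-⊕ : (A : Subset n) (𝒞 : Subset n → Bool) (B : Subset n) → inXorFamily A 𝒞 B ≡ 𝒞 (A ⊕ B)
inXorFamily-⊕ {n} A 𝒞 B =
  trans (cong or (map-cong (λ C → cong (𝒞 C ∧_) (solve-for C)) (allSubsets n))) (any-allSubsets-δ 𝒞 (A ⊕ B))
  where
  solve-for : ∀ C → (B == (A ⊕ C)) ≡ (C == (A ⊕ B))
  solve-for C = ==-⇔ (mk⇔ (λ eq → trans (sym (⊕-cancelˡ A C)) (cong (A ⊕_) (sym eq)))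
                          (λ eq → trans (sym (⊕-cancelˡ A B)) (cong (A ⊕_) (sym eq))))
                     (≡-dec Bool._≟_ C (A ⊕ B))

-- The coordinate (Y, Y ⊕ {a}) of Λ

occurs : Fin n → List (Fin n) → Bool
occurs a = any (λ i → ⌊ a ≟ i ⌋)

-- Built with ⊕ so that the path from X along l flips a exactly at X ⊕ before a l; meaningful only
-- when a occurs in l.
before : Fin n → List (Fin n) → Subset n
before a [] = ⊥
before a (i ∷ l) = if ⌊ a ≟ i ⌋ then ⊥ else before a l ⊕ ⁅ i ⁆

distinct-∷ : {i : Fin n} (l : List (Fin n)) → distinct (i ∷ l) ≡ true → occurs i l ≡ false × distinct l ≡ true
distinct-∷ {i = i} l d with occurs i l | distinct l
distinct-∷ l refl | false | true = refl , refl

before-∌ : (a : Fin n) (l : List (Fin n)) → lookup (before a l) a ≡ false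
before-∌ a [] = lookup-replicate a false
before-∌ a (i ∷ l) with a ≟ i
... | yes _ = lookup-replicate a false
... | no a≢i = trans (lookup-⊕ (before a l) ⁅ i ⁆ a) (cong₂ _xor_ (before-∌ a l) (lookup-⁅⁆-≢ (a≢i ∘ sym)))

𝟙-ρ-split : (F : Family n) → SubsetClosed F → (a : Fin n) (C : Subset n) → lookup C a ≡ false →
            𝟙 (F C) ≡ 𝟙 (F (C ∪ ⁅ a ⁆)) + 𝟙 (ρ F a C)
𝟙-ρ-split F closed a C a∉C rewrite a∉C with F (C ∪ ⁅ a ⁆) in C∪a∈F
... | true rewrite closed (C ∪ ⁅ a ⁆) C (p⊆p∪q ⁅ a ⁆) C∪a∈F = refl
... | false with F C
...   | true = refl
...   | false = refl

pos-+-minus : (m n : ℕ) → pos (m + n) - pos m ≡ pos n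
pos-+-minus m n = begin
  pos (m + n) - pos m ≡⟨ ℤ.[+m]-[+n]≡m⊖n (m + n) m ⟩
  (m + n) ⊖ m         ≡⟨ ℤ.≤-⊖ (m≤m+n m n) ⟩
  pos (m + n ∸ m)     ≡⟨ cong pos (m+n∸m≡n m n) ⟩
  pos n ∎
  where open ≡-Reasoning

∑-permutations : (n : ℕ) → (List (Fin n) → ℕ) → ℕ
∑-permutations n h = ∑[ σ ∈ allVecs n n ] 𝟙 (distinct (toList σ)) * h (toList σ)

module Path (Y : Subset n) (a : Fin n) where

  pathCoord : Subset n → List (Fin n) → ℤ
  pathCoord X l = sumℤ (map (edgeCoord Y (Y ⊕ ⁅ a ⁆)) (pathSteps X l))

  ⊕⁅⁆-==-⊕⁅⁆ : (X : Subset n) (s : Fin n) → ((X ⊕ ⁅ s ⁆) == (X ⊕ ⁅ a ⁆)) ≡ ⌊ a ≟ s ⌋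
  ⊕⁅⁆-==-⊕⁅⁆ X s = ==-⇔ (mk⇔ (λ eq → sym (⁅⁆-injective (⊕-injectiveˡ X eq))) (λ { refl → refl })) (a ≟ s)

  step-enters : (X Z : Subset n) (s : Fin n) → (X == Z) ∧ ((X ⊕ ⁅ s ⁆) == (Z ⊕ ⁅ a ⁆)) ≡ ⌊ a ≟ s ⌋ ∧ (X == Z)
  step-enters X Z s = trans (∧-congˡ-true (λ X==Z → subst (λ W → ((X ⊕ ⁅ s ⁆) == (W ⊕ ⁅ a ⁆)) ≡ ⌊ a ≟ s ⌋)
                                                            (==-sound X==Z) (⊕⁅⁆-==-⊕⁅⁆ X s)))
                            (Bool.∧-comm (X == Z) ⌊ a ≟ s ⌋)

  edgeCoord-step : (X : Subset n) (s : Fin n) →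
    edgeCoord Y (Y ⊕ ⁅ a ⁆) (X , X ⊕ ⁅ s ⁆)
    ≡ indicator (⌊ a ≟ s ⌋ ∧ (X == Y)) - indicator (⌊ a ≟ s ⌋ ∧ (X == (Y ⊕ ⁅ a ⁆)))
  edgeCoord-step X s = cong₂ (λ u v → indicator u - indicator v) (step-enters X Y s) backward
    where
    backward : ((X ⊕ ⁅ s ⁆) == Y) ∧ (X == (Y ⊕ ⁅ a ⁆)) ≡ ⌊ a ≟ s ⌋ ∧ (X == (Y ⊕ ⁅ a ⁆))
    backward = begin
      ((X ⊕ ⁅ s ⁆) == Y) ∧ (X == (Y ⊕ ⁅ a ⁆))
        ≡⟨ cong (λ W → ((X ⊕ ⁅ s ⁆) == W) ∧ (X == (Y ⊕ ⁅ a ⁆))) (sym (⊕-cancelʳ Y ⁅ a ⁆)) ⟩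
      ((X ⊕ ⁅ s ⁆) == ((Y ⊕ ⁅ a ⁆) ⊕ ⁅ a ⁆)) ∧ (X == (Y ⊕ ⁅ a ⁆))
        ≡⟨ Bool.∧-comm ((X ⊕ ⁅ s ⁆) == ((Y ⊕ ⁅ a ⁆) ⊕ ⁅ a ⁆)) (X == (Y ⊕ ⁅ a ⁆)) ⟩
      (X == (Y ⊕ ⁅ a ⁆)) ∧ ((X ⊕ ⁅ s ⁆) == ((Y ⊕ ⁅ a ⁆) ⊕ ⁅ a ⁆))
        ≡⟨ step-enters X (Y ⊕ ⁅ a ⁆) s ⟩
      ⌊ a ≟ s ⌋ ∧ (X == (Y ⊕ ⁅ a ⁆)) ∎
      where open ≡-Reasoning

  pathCoord-injective : (X : Subset n) (l : List (Fin n)) → distinct l ≡ true →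
    pathCoord X l ≡ indicator (occurs a l ∧ (X == (Y ⊕ before a l)))
                  - indicator (occurs a l ∧ (X == ((Y ⊕ ⁅ a ⁆) ⊕ before a l)))
  pathCoord-injective X [] _ = refl
  pathCoord-injective X (s ∷ l) d with distinct-∷ l d
  ... | s∉l , l-distinct rewrite edgeCoord-step X s with a ≟ s
  ... | yes refl rewrite pathCoord-injective (X ⊕ ⁅ a ⁆) l l-distinct | s∉l | ⊕-identityʳ Y | ⊕-identityʳ (Y ⊕ ⁅ a ⁆) =
    ℤ.+-identityʳ _
  ... | no _ rewrite pathCoord-injective (X ⊕ ⁅ s ⁆) l l-distinct =
    trans (ℤ.+-identityˡ _)
          (cong₂ (λ u v → indicator (occurs a l ∧ u) - indicator (occurs a l ∧ v)) (shift Y) (shift (Y ⊕ ⁅ a ⁆)))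
    where
    shift : (W : Subset n) → ((X ⊕ ⁅ s ⁆) == (W ⊕ before a l)) ≡ (X == (W ⊕ (before a l ⊕ ⁅ s ⁆)))
    shift W = trans (⊕-==ˡ X ⁅ s ⁆ (W ⊕ before a l)) (cong (X ==_) (⊕-assoc W (before a l) ⁅ s ⁆))

  pathCoord-family : (F : Family n) (l : List (Fin n)) → distinct l ≡ true →
    sumℤ (map (λ X → pathCoord X l) (filter (λ X → F X Bool.≟ true) (allSubsets n)))
    ≡ pos (𝟙 (occurs a l) * 𝟙 (F (Y ⊕ before a l))) - pos (𝟙 (occurs a l) * 𝟙 (F ((Y ⊕ ⁅ a ⁆) ⊕ before a l)))
  pathCoord-family F l d = begin
    ∑ℤ (filter (λ X → F X Bool.≟ true) (allSubsets n)) (λ X → pathCoord X l)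
      ≡⟨ ∑ℤ-filter F (allSubsets n) (λ X → pathCoord X l) ⟩
    ∑ℤ[ X ∈ allSubsets n ] (if F X then pathCoord X l else pos 0)
      ≡⟨ ∑ℤ-cong (allSubsets n) (λ X → restrict X (F X)) ⟩
    ∑ℤ[ X ∈ allSubsets n ] (pos (𝟙 (F X) * 𝟙 (occurs a l ∧ (X == (Y ⊕ before a l))))
                          - pos (𝟙 (F X) * 𝟙 (occurs a l ∧ (X == ((Y ⊕ ⁅ a ⁆) ⊕ before a l)))))
      ≡⟨ ∑ℤ-pos-minus (allSubsets n) _ _ ⟩
    pos (∑[ X ∈ allSubsets n ] 𝟙 (F X) * 𝟙 (occurs a l ∧ (X == (Y ⊕ before a l))))
    - pos (∑[ X ∈ allSubsets n ] 𝟙 (F X) * 𝟙 (occurs a l ∧ (X == ((Y ⊕ ⁅ a ⁆) ⊕ before a l))))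
      ≡⟨ cong₂ (λ u v → pos u - pos v) (∑-allSubsets-δ-∧ F (occurs a l) _) (∑-allSubsets-δ-∧ F (occurs a l) _) ⟩
    pos (𝟙 (occurs a l) * 𝟙 (F (Y ⊕ before a l))) - pos (𝟙 (occurs a l) * 𝟙 (F ((Y ⊕ ⁅ a ⁆) ⊕ before a l))) ∎
    where
    open ≡-Reasoning
    restrict : ∀ X b → (if b then pathCoord X l else pos 0)
      ≡ pos (𝟙 b * 𝟙 (occurs a l ∧ (X == (Y ⊕ before a l))))
      - pos (𝟙 b * 𝟙 (occurs a l ∧ (X == ((Y ⊕ ⁅ a ⁆) ⊕ before a l))))
    restrict X false = refl
    restrict X true = trans (pathCoord-injective X l d) (cong₂ _-_ (one-times (occurs a l ∧ (X == (Y ⊕ before a l))))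
                                                                (one-times (occurs a l ∧ (X == ((Y ⊕ ⁅ a ⁆) ⊕ before a l)))))
      where
      one-times : ∀ b → indicator b ≡ pos (1 * 𝟙 b)
      one-times b = trans (indicator≡+𝟙 b) (cong pos (sym (*-identityˡ (𝟙 b))))

  pathCoord-family-closed : (F : Family n) → SubsetClosed F → lookup Y a ≡ false →
    (l : List (Fin n)) → distinct l ≡ true →
    sumℤ (map (λ X → pathCoord X l) (filter (λ X → F X Bool.≟ true) (allSubsets n)))
    ≡ pos (𝟙 (occurs a l) * 𝟙 (ρ F a (Y ⊕ before a l)))
  pathCoord-family-closed F closed a∉Y l d = begin
    sumℤ (map (λ X → pathCoord X l) (filter (λ X → F X Bool.≟ true) (allSubsets n)))
      ≡⟨ pathCoord-family F l d ⟩
    pos (h * 𝟙 (F C)) - pos (h * 𝟙 (F ((Y ⊕ ⁅ a ⁆) ⊕ before a l)))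
      ≡⟨ cong (λ W → pos (h * 𝟙 (F C)) - pos (h * 𝟙 (F W))) shift-a ⟩
    pos (h * 𝟙 (F C)) - pos (h * 𝟙 (F (C ∪ ⁅ a ⁆)))
      ≡⟨ cong (λ k → pos (h * k) - pos (h * 𝟙 (F (C ∪ ⁅ a ⁆)))) (𝟙-ρ-split F closed a C a∉C) ⟩
    pos (h * (𝟙 (F (C ∪ ⁅ a ⁆)) + 𝟙 (ρ F a C))) - pos (h * 𝟙 (F (C ∪ ⁅ a ⁆)))
      ≡⟨ cong (λ k → pos k - pos (h * 𝟙 (F (C ∪ ⁅ a ⁆)))) (*-distribˡ-+ h _ _) ⟩
    pos (h * 𝟙 (F (C ∪ ⁅ a ⁆)) + h * 𝟙 (ρ F a C)) - pos (h * 𝟙 (F (C ∪ ⁅ a ⁆)))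
      ≡⟨ pos-+-minus (h * 𝟙 (F (C ∪ ⁅ a ⁆))) (h * 𝟙 (ρ F a C)) ⟩
    pos (h * 𝟙 (ρ F a C)) ∎
    where
    open ≡-Reasoning
    h = 𝟙 (occurs a l)
    C = Y ⊕ before a l
    a∉C : lookup C a ≡ false
    a∉C = trans (lookup-⊕ Y (before a l) a) (cong₂ _xor_ a∉Y (before-∌ a l))
    shift-a : (Y ⊕ ⁅ a ⁆) ⊕ before a l ≡ C ∪ ⁅ a ⁆
    shift-a = begin
      (Y ⊕ ⁅ a ⁆) ⊕ before a l ≡⟨ ⊕-assoc Y ⁅ a ⁆ (before a l) ⟩
      Y ⊕ (⁅ a ⁆ ⊕ before a l) ≡⟨ cong (Y ⊕_) (⊕-comm ⁅ a ⁆ (before a l)) ⟩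
      Y ⊕ (before a l ⊕ ⁅ a ⁆) ≡⟨ sym (⊕-assoc Y (before a l) ⁅ a ⁆) ⟩
      C ⊕ ⁅ a ⁆                ≡⟨ ⊕⁅⁆≡∪⁅⁆ C a a∉C ⟩
      C ∪ ⁅ a ⁆ ∎

Λ-edge : (F : Family n) → SubsetClosed F → (a : Fin n) (Y : Subset n) → lookup Y a ≡ false →
  Λ F Y (Y ⊕ ⁅ a ⁆) ≡ pos (∑-permutations n (λ σ → 𝟙 (occurs a σ) * 𝟙 (ρ F a (Y ⊕ before a σ))))
Λ-edge {n} F closed a Y a∉Y = begin
  Λ F Y (Y ⊕ ⁅ a ⁆)
    ≡⟨ ∑ℤ-filter (λ σ → distinct (toList σ)) (allVecs n n) (λ σ → inner (toList σ)) ⟩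
  ∑ℤ[ σ ∈ allVecs n n ] (if distinct (toList σ) then inner (toList σ) else pos 0)
    ≡⟨ ∑ℤ-cong (allVecs n n) (λ σ → restrict (toList σ)) ⟩
  ∑ℤ[ σ ∈ allVecs n n ] pos (g (toList σ))
    ≡⟨ ∑ℤ-pos (allVecs n n) (λ σ → g (toList σ)) ⟩
  pos (∑-permutations n (λ σ → 𝟙 (occurs a σ) * 𝟙 (ρ F a (Y ⊕ before a σ)))) ∎
  where
  open ≡-Reasoning
  open Path Y a
  inner : List (Fin n) → ℤ
  inner l = sumℤ (map (λ X → pathCoord X l) (filter (λ X → F X Bool.≟ true) (allSubsets n)))
  g : List (Fin n) → ℕ
  g l = 𝟙 (distinct l) * (𝟙 (occurs a l) * 𝟙 (ρ F a (Y ⊕ before a l)))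
  restrict : ∀ l → (if distinct l then inner l else pos 0) ≡ pos (g l)
  restrict l with distinct l in d
  ... | false = refl
  ... | true = trans (pathCoord-family-closed F closed a∉Y l d) (cong pos (sym (+-identityʳ _)))

-- Counting permutations by the entries preceding a

∑-allFin-suc : (f : Fin (suc n) → ℕ) → ∑ (allFin (suc n)) f ≡ f zero + (∑[ i ∈ allFin n ] f (suc i))
∑-allFin-suc {n} f = cong (f zero +_) (trans (cong (λ l → ∑ l f) (sym (map-tabulate (λ i → i) suc))) (∑-map suc (allFin n) f))

∑-allFin-lookup : (B : Subset n) → ∑[ i ∈ allFin n ] 𝟙 (lookup B i) ≡ ∣ B ∣
∑-allFin-lookup [] = refl
∑-allFin-lookup (false ∷ B) = trans (∑-allFin-suc (λ i → 𝟙 (lookup (false ∷ B) i))) (∑-allFin-lookup B)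
∑-allFin-lookup (true ∷ B) = trans (∑-allFin-suc (λ i → 𝟙 (lookup (true ∷ B) i))) (cong suc (∑-allFin-lookup B))

∑-allFin-lookup-* : (B : Subset n) (x : ℕ) → ∑[ i ∈ allFin n ] 𝟙 (lookup B i) * x ≡ ∣ B ∣ * x
∑-allFin-lookup-* {n} B x = trans (∑-*ʳ (allFin n) x (λ i → 𝟙 (lookup B i))) (cong (_* x) (∑-allFin-lookup B))

∑-allFin-∉ : (K : Subset n) → ∑[ i ∈ allFin n ] 𝟙 (not (lookup K i)) ≡ n ∸ ∣ K ∣
∑-allFin-∉ {n} K = begin
  ∑[ i ∈ allFin n ] 𝟙 (not (lookup K i)) ≡⟨ ∑-cong (allFin n) (λ i → cong 𝟙 (sym (lookup-map i not K))) ⟩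
  ∑[ i ∈ allFin n ] 𝟙 (lookup (∁ K) i)   ≡⟨ ∑-allFin-lookup (∁ K) ⟩
  ∣ ∁ K ∣                                ≡⟨ ∣∁p∣≡n∸∣p∣ K ⟩
  n ∸ ∣ K ∣ ∎
  where open ≡-Reasoning

avoids : Subset n → List (Fin n) → Bool
avoids K [] = true
avoids K (i ∷ l) = not (lookup K i) ∧ avoids K l

avoids-⊥ : (l : List (Fin n)) → avoids ⊥ l ≡ true
avoids-⊥ [] = refl
avoids-⊥ (i ∷ l) rewrite lookup-replicate i false = avoids-⊥ l

avoids-∪⁅⁆ : (K : Subset n) (i : Fin n) (l : List (Fin n)) → avoids (K ∪ ⁅ i ⁆) l ≡ not (occurs i l) ∧ avoids K l
avoids-∪⁅⁆ K i [] = refl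
avoids-∪⁅⁆ K i (j ∷ l) rewrite lookup-∪ K ⁅ i ⁆ j | lookup-⁅⁆ i j | avoids-∪⁅⁆ K i l =
  rearrange (lookup K j) ⌊ i ≟ j ⌋ (occurs i l) (avoids K l)
  where
  rearrange : ∀ k e o w → not (k ∨ e) ∧ (not o ∧ w) ≡ not (e ∨ o) ∧ (not k ∧ w)
  rearrange true e o w = sym (Bool.∧-zeroʳ (not (e ∨ o)))
  rearrange false true o w = refl
  rearrange false false o w = refl

injectiveAvoiding : Subset n → List (Fin n) → Bool
injectiveAvoiding K l = distinct l ∧ avoids K l

injectiveAvoiding-∷ : (K : Subset n) (i : Fin n) (l : List (Fin n)) →
  injectiveAvoiding K (i ∷ l) ≡ not (lookup K i) ∧ injectiveAvoiding (K ∪ ⁅ i ⁆) l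
injectiveAvoiding-∷ K i l rewrite avoids-∪⁅⁆ K i l =
  rearrange (not (occurs i l)) (distinct l) (not (lookup K i)) (avoids K l)
  where
  rearrange : ∀ x y z w → (x ∧ y) ∧ (z ∧ w) ≡ z ∧ (y ∧ (x ∧ w))
  rearrange true true z w = refl
  rearrange true false z w = sym (Bool.∧-zeroʳ z)
  rearrange false y z w rewrite Bool.∧-zeroʳ y = sym (Bool.∧-zeroʳ z)

∑-arrangements : Subset n → ℕ → (List (Fin n) → ℕ) → ℕ
∑-arrangements {n} K m f = ∑[ v ∈ allVecs n m ] 𝟙 (injectiveAvoiding K (toList v)) * f (toList v)

∑-arrangements-cong : (K : Subset n) (m : ℕ) {f g : List (Fin n) → ℕ} → (∀ l → f l ≡ g l) →
                      ∑-arrangements K m f ≡ ∑-arrangements K m g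
∑-arrangements-cong {n} K m f≗g = ∑-cong (allVecs n m) (λ v → cong (𝟙 (injectiveAvoiding K (toList v)) *_) (f≗g (toList v)))

∑-arrangements-suc : (K : Subset n) (m : ℕ) (f : List (Fin n) → ℕ) →
  ∑-arrangements K (suc m) f ≡ ∑[ i ∈ allFin n ] 𝟙 (not (lookup K i)) * ∑-arrangements (K ∪ ⁅ i ⁆) m (λ l → f (i ∷ l))
∑-arrangements-suc {n} K m f = trans (∑-concatMap (λ i → map (i ∷_) (allVecs n m)) (allFin n) _)
  (∑-cong (allFin n) λ i → trans (∑-map (i ∷_) (allVecs n m) _)
    (trans (∑-cong (allVecs n m) (λ v → first-entry i (toList v)))
           (∑-*ˡ (allVecs n m) (𝟙 (not (lookup K i))) _)))
  where
  first-entry : ∀ i l → 𝟙 (injectiveAvoiding K (i ∷ l)) * f (i ∷ l)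
                        ≡ 𝟙 (not (lookup K i)) * (𝟙 (injectiveAvoiding (K ∪ ⁅ i ⁆) l) * f (i ∷ l))
  first-entry i l rewrite injectiveAvoiding-∷ K i l | 𝟙-∧ (not (lookup K i)) (injectiveAvoiding (K ∪ ⁅ i ⁆) l) =
    *-assoc (𝟙 (not (lookup K i))) _ (f (i ∷ l))

module _ (K : Subset n) (m : ℕ) (∣K∣+1+m≡n : ∣ K ∣ + suc m ≡ n) where

  ∣K∪⁅i⁆∣+m≡n : (i : Fin n) → lookup K i ≡ false → ∣ K ∪ ⁅ i ⁆ ∣ + m ≡ n
  ∣K∪⁅i⁆∣+m≡n i i∉K = trans (cong (_+ m) (∣p∪⁅i⁆∣ K i i∉K)) (trans (sym (+-suc ∣ K ∣ m)) ∣K∣+1+m≡n)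

  ∑-allFin-∉-suc : ∑[ i ∈ allFin n ] 𝟙 (not (lookup K i)) ≡ suc m
  ∑-allFin-∉-suc = trans (∑-allFin-∉ K) (trans (cong (_∸ ∣ K ∣) (sym ∣K∣+1+m≡n)) (m+n∸m≡n ∣ K ∣ (suc m)))

∑-arrangements-const : (K : Subset n) (m c : ℕ) → ∣ K ∣ + m ≡ n → ∑-arrangements K m (λ _ → c) ≡ m ! * c
∑-arrangements-const K zero c _ = +-identityʳ _
∑-arrangements-const {n} K (suc m) c ∣K∣+1+m≡n = begin
  ∑-arrangements K (suc m) (λ _ → c)
    ≡⟨ ∑-arrangements-suc K m (λ _ → c) ⟩
  ∑[ i ∈ allFin n ] 𝟙 (not (lookup K i)) * ∑-arrangements (K ∪ ⁅ i ⁆) m (λ _ → c)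
    ≡⟨ ∑-cong (allFin n) (λ i → 𝟙-*-cong (λ i∉K → ∑-arrangements-const (K ∪ ⁅ i ⁆) m c
                                                    (∣K∪⁅i⁆∣+m≡n K m ∣K∣+1+m≡n i (Bool.not-injective i∉K)))) ⟩
  ∑[ i ∈ allFin n ] 𝟙 (not (lookup K i)) * (m ! * c)
    ≡⟨ ∑-*ʳ (allFin n) (m ! * c) (λ i → 𝟙 (not (lookup K i))) ⟩
  (∑[ i ∈ allFin n ] 𝟙 (not (lookup K i))) * (m ! * c)
    ≡⟨ cong (_* (m ! * c)) (∑-allFin-∉-suc K m ∣K∣+1+m≡n) ⟩
  suc m * (m ! * c)
    ≡⟨ sym (*-assoc (suc m) (m !) c) ⟩
  suc m ! * c ∎
  where open ≡-Reasoning

disjoint : Subset n → Subset n → Bool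
disjoint [] [] = true
disjoint (b ∷ B) (k ∷ K) = not (b ∧ k) ∧ disjoint B K

disjoint-⊥ˡ : (K : Subset n) → disjoint ⊥ K ≡ true
disjoint-⊥ˡ [] = refl
disjoint-⊥ˡ (k ∷ K) = disjoint-⊥ˡ K

disjoint-⊥ʳ : (B : Subset n) → disjoint B ⊥ ≡ true
disjoint-⊥ʳ [] = refl
disjoint-⊥ʳ (b ∷ B) rewrite Bool.∧-zeroʳ b = disjoint-⊥ʳ B

disjoint-∈ : (B K : Subset n) (i : Fin n) → lookup B i ≡ true → lookup K i ≡ true → disjoint B K ≡ false
disjoint-∈ (true ∷ B) (true ∷ K) zero _ _ = refl
disjoint-∈ (b ∷ B) (k ∷ K) (suc i) i∈B i∈K rewrite disjoint-∈ B K i i∈B i∈K = Bool.∧-zeroʳ _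

disjoint-⊕⁅⁆ : (B K : Subset n) (i : Fin n) → lookup K i ≡ false →
               disjoint (B ⊕ ⁅ i ⁆) (K ∪ ⁅ i ⁆) ≡ lookup B i ∧ disjoint B K
disjoint-⊕⁅⁆ (b ∷ B) (false ∷ K) zero _ rewrite ⊕-identityʳ B | ∪-identityʳ K with b
... | true = refl
... | false = refl
disjoint-⊕⁅⁆ (b ∷ B) (k ∷ K) (suc i) i∉K
  rewrite Bool.xor-identityʳ b | Bool.∨-identityʳ k | disjoint-⊕⁅⁆ B K i i∉K =
  ∧-Props.x∙yz≈y∙xz (not (b ∧ k)) (lookup B i) (disjoint B K)

-- the number of orderings of m elements in which a given element is preceded by a given set of k others
precededCount : ℕ → ℕ → ℕ
precededCount m k = k ! * (m ∸ 1 ∸ k) !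

module CountBefore (a : Fin n) where

  beforeIs : Subset n → List (Fin n) → ℕ
  beforeIs B l = 𝟙 (occurs a l ∧ (B == before a l))

  beforeIs-a : (B : Subset n) (l : List (Fin n)) → beforeIs B (a ∷ l) ≡ 𝟙 (B == ⊥)
  beforeIs-a B l with a ≟ a
  ... | yes _ = refl
  ... | no a≢a = contradiction refl a≢a

  beforeIs-≢ : (B : Subset n) {i : Fin n} (l : List (Fin n)) → a ≢ i → beforeIs B (i ∷ l) ≡ beforeIs (B ⊕ ⁅ i ⁆) l
  beforeIs-≢ B {i} l a≢i with a ≟ i
  ... | yes a≡i = contradiction a≡i a≢i
  ... | no _ = cong (λ b → 𝟙 (occurs a l ∧ b)) (sym (⊕-==ˡ B ⁅ i ⁆ (before a l)))

  CountsBefore : ℕ → Set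
  CountsBefore m = (K B : Subset n) → lookup K a ≡ false → lookup B a ≡ false → ∣ K ∣ + m ≡ n →
                   ∑-arrangements K m (beforeIs B) ≡ 𝟙 (disjoint B K) * precededCount m ∣ B ∣

  countsBefore-zero : CountsBefore zero
  countsBefore-zero K B a∉K _ ∣K∣+0≡n with ∣p∣≡n⇒p≡⊤ {p = K} (trans (sym (+-identityʳ ∣ K ∣)) ∣K∣+0≡n)
  ... | refl = contradiction (trans (sym (lookup-replicate a true)) a∉K) λ ()

  module Step {m : ℕ} (hyp : CountsBefore m) (K B : Subset n) (a∉K : lookup K a ≡ false) (a∉B : lookup B a ≡ false)
              (∣K∣+1+m≡n : ∣ K ∣ + suc m ≡ n) where

    term : Fin n → ℕ
    term i = 𝟙 (not (lookup K i)) * ∑-arrangements (K ∪ ⁅ i ⁆) m (λ l → beforeIs B (i ∷ l))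

    term-a : term a ≡ m ! * 𝟙 (B == ⊥)
    term-a rewrite a∉K = trans (*-identityˡ _) (trans (∑-arrangements-cong (K ∪ ⁅ a ⁆) m (beforeIs-a B))
                                            (∑-arrangements-const (K ∪ ⁅ a ⁆) m _ (∣K∪⁅i⁆∣+m≡n K m ∣K∣+1+m≡n a a∉K)))
    term-≢ : (i : Fin n) → a ≢ i → term i ≡ 𝟙 (lookup B i) * (𝟙 (disjoint B K) * precededCount m (pred ∣ B ∣))
    term-≢ i a≢i with lookup K i in i∈K? | lookup B i in i∈B?
    ... | true | false = refl
    ... | true | true rewrite disjoint-∈ B K i i∈B? i∈K? = refl
    ... | false | b = trans (*-identityˡ _) (begin
      ∑-arrangements (K ∪ ⁅ i ⁆) m (λ l → beforeIs B (i ∷ l))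
        ≡⟨ ∑-arrangements-cong (K ∪ ⁅ i ⁆) m (λ l → beforeIs-≢ B l a≢i) ⟩
      ∑-arrangements (K ∪ ⁅ i ⁆) m (beforeIs (B ⊕ ⁅ i ⁆))
        ≡⟨ hyp (K ∪ ⁅ i ⁆) (B ⊕ ⁅ i ⁆) a∉K∪⁅i⁆ a∉B⊕⁅i⁆ (∣K∪⁅i⁆∣+m≡n K m ∣K∣+1+m≡n i i∈K?) ⟩
      𝟙 (disjoint (B ⊕ ⁅ i ⁆) (K ∪ ⁅ i ⁆)) * precededCount m ∣ B ⊕ ⁅ i ⁆ ∣
        ≡⟨ cong (λ c → 𝟙 c * precededCount m ∣ B ⊕ ⁅ i ⁆ ∣) (trans (disjoint-⊕⁅⁆ B K i i∈K?) (cong (_∧ disjoint B K) i∈B?)) ⟩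
      𝟙 (b ∧ disjoint B K) * precededCount m ∣ B ⊕ ⁅ i ⁆ ∣
        ≡⟨ drop-i b i∈B? ⟩
      𝟙 b * (𝟙 (disjoint B K) * precededCount m (pred ∣ B ∣)) ∎)
      where
      open ≡-Reasoning
      drop-i : ∀ b → lookup B i ≡ b →
               𝟙 (b ∧ disjoint B K) * precededCount m ∣ B ⊕ ⁅ i ⁆ ∣ ≡ 𝟙 b * (𝟙 (disjoint B K) * precededCount m (pred ∣ B ∣))
      drop-i false _ = refl
      drop-i true i∈B rewrite sym (∣p⊕⁅i⁆∣ B i i∈B) = sym (*-identityˡ _)
      a∉K∪⁅i⁆ : lookup (K ∪ ⁅ i ⁆) a ≡ false
      a∉K∪⁅i⁆ = trans (lookup-∪ K ⁅ i ⁆ a) (cong₂ _∨_ a∉K (lookup-⁅⁆-≢ (a≢i ∘ sym)))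
      a∉B⊕⁅i⁆ : lookup (B ⊕ ⁅ i ⁆) a ≡ false
      a∉B⊕⁅i⁆ = trans (lookup-⊕ B ⁅ i ⁆ a) (cong₂ _xor_ a∉B (lookup-⁅⁆-≢ (a≢i ∘ sym)))

    term-split : (i : Fin n) → term i ≡ 𝟙 (lookup ⁅ a ⁆ i) * (m ! * 𝟙 (B == ⊥))
                                       + 𝟙 (lookup B i) * (𝟙 (disjoint B K) * precededCount m (pred ∣ B ∣))
    term-split i = split i (a ≟ i)
      where
      split : (i : Fin n) → Dec (a ≡ i) → term i ≡ 𝟙 (lookup ⁅ a ⁆ i) * (m ! * 𝟙 (B == ⊥))
                                                  + 𝟙 (lookup B i) * (𝟙 (disjoint B K) * precededCount m (pred ∣ B ∣))
      split .a (yes refl) rewrite lookup-⁅i⁆-i a | a∉B = trans term-a (sym (trans (+-identityʳ _) (*-identityˡ _)))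
      split i (no a≢i) rewrite lookup-⁅⁆-≢ a≢i = term-≢ i a≢i

    precededCount-suc : 1 * (m ! * 𝟙 (B == ⊥)) + ∣ B ∣ * (𝟙 (disjoint B K) * precededCount m (pred ∣ B ∣))
                        ≡ 𝟙 (disjoint B K) * precededCount (suc m) ∣ B ∣
    precededCount-suc with ∣ B ∣ in ∣B∣≡
    ... | zero rewrite ∣p∣≡0⇒p≡⊥ B ∣B∣≡ | ==-refl (⊥ {n}) | disjoint-⊥ˡ K = arith (m !)
      where
      arith : ∀ x → 1 * (x * 1) + 0 ≡ 1 * (1 * x)
      arith = solve-∀
    ... | suc k rewrite ==-refute (∣p∣≡1+k⇒p≢⊥ B ∣B∣≡) | ∸-+-assoc m 1 k = arith (m !) k (𝟙 (disjoint B K)) (k !) ((m ∸ suc k) !)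
      where
      arith : ∀ x k d y r → 1 * (x * 0) + suc k * (d * (y * r)) ≡ d * (suc k * y * r)
      arith = solve-∀

    countsBefore-suc : ∑-arrangements K (suc m) (beforeIs B) ≡ 𝟙 (disjoint B K) * precededCount (suc m) ∣ B ∣
    countsBefore-suc = begin
      ∑-arrangements K (suc m) (beforeIs B)
        ≡⟨ ∑-arrangements-suc K m (beforeIs B) ⟩
      ∑[ i ∈ allFin n ] term i
        ≡⟨ ∑-cong (allFin n) term-split ⟩
      ∑[ i ∈ allFin n ] (𝟙 (lookup ⁅ a ⁆ i) * x + 𝟙 (lookup B i) * y)
        ≡⟨ ∑-+ (allFin n) (λ i → 𝟙 (lookup ⁅ a ⁆ i) * x) (λ i → 𝟙 (lookup B i) * y) ⟩
      (∑[ i ∈ allFin n ] 𝟙 (lookup ⁅ a ⁆ i) * x) + (∑[ i ∈ allFin n ] 𝟙 (lookup B i) * y)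
        ≡⟨ cong₂ _+_ (∑-allFin-lookup-* ⁅ a ⁆ x) (∑-allFin-lookup-* B y) ⟩
      ∣ ⁅ a ⁆ ∣ * x + ∣ B ∣ * y
        ≡⟨ cong (λ k → k * x + ∣ B ∣ * y) (∣⁅x⁆∣≡1 a) ⟩
      1 * x + ∣ B ∣ * y
        ≡⟨ precededCount-suc ⟩
      𝟙 (disjoint B K) * precededCount (suc m) ∣ B ∣ ∎
      where
      open ≡-Reasoning
      x = m ! * 𝟙 (B == ⊥)
      y = 𝟙 (disjoint B K) * precededCount m (pred ∣ B ∣)

  countsBefore : (m : ℕ) → CountsBefore m
  countsBefore zero = countsBefore-zero
  countsBefore (suc m) K B a∉K a∉B ∣K∣+1+m≡n = Step.countsBefore-suc (countsBefore m) K B a∉K a∉B ∣K∣+1+m≡n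

∑-permutations-before : (a : Fin n) (G : Subset n → Bool) → (∀ B → G B ≡ true → lookup B a ≡ false) →
  ∑-permutations n (λ σ → 𝟙 (occurs a σ) * 𝟙 (G (before a σ))) ≡ ∑[ B ∈ allSubsets n ] 𝟙 (G B) * precededCount n ∣ B ∣
∑-permutations-before {n} a G G⇒a∉ = begin
  ∑-permutations n (λ σ → 𝟙 (occurs a σ) * 𝟙 (G (before a σ)))
    ≡⟨ ∑-cong (allVecs n n) (λ σ → cong₂ _*_ (injectiveAvoiding-⊥ (toList σ)) (sym (∑-allSubsets-δ-∧ G _ _))) ⟩
  ∑[ σ ∈ allVecs n n ] 𝟙 (injectiveAvoiding ⊥ (toList σ)) * (∑[ B ∈ allSubsets n ] 𝟙 (G B) * beforeIs B (toList σ))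
    ≡⟨ ∑-cong (allVecs n n) (λ σ → sym (∑-*ˡ (allSubsets n) (𝟙 (injectiveAvoiding ⊥ (toList σ))) (λ B → 𝟙 (G B) * beforeIs B (toList σ)))) ⟩
  ∑[ σ ∈ allVecs n n ] ∑[ B ∈ allSubsets n ] 𝟙 (injectiveAvoiding ⊥ (toList σ)) * (𝟙 (G B) * beforeIs B (toList σ))
    ≡⟨ ∑-comm (allVecs n n) (allSubsets n) _ ⟩
  ∑[ B ∈ allSubsets n ] ∑[ σ ∈ allVecs n n ] 𝟙 (injectiveAvoiding ⊥ (toList σ)) * (𝟙 (G B) * beforeIs B (toList σ))
    ≡⟨ ∑-cong (allSubsets n) (λ B → trans (∑-cong (allVecs n n) (λ σ → *-Props.x∙yz≈y∙xz (𝟙 (injectiveAvoiding ⊥ (toList σ))) (𝟙 (G B)) (beforeIs B (toList σ))))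
                                          (∑-*ˡ (allVecs n n) (𝟙 (G B)) (λ σ → 𝟙 (injectiveAvoiding ⊥ (toList σ)) * beforeIs B (toList σ)))) ⟩
  ∑[ B ∈ allSubsets n ] 𝟙 (G B) * ∑-arrangements ⊥ n (beforeIs B)
    ≡⟨ ∑-cong (allSubsets n) (λ B → 𝟙-*-cong (count B)) ⟩
  ∑[ B ∈ allSubsets n ] 𝟙 (G B) * precededCount n ∣ B ∣ ∎
  where
  open ≡-Reasoning
  open CountBefore a
  injectiveAvoiding-⊥ : ∀ l → 𝟙 (distinct l) ≡ 𝟙 (injectiveAvoiding ⊥ l)
  injectiveAvoiding-⊥ l = cong 𝟙 (sym (trans (cong (distinct l ∧_) (avoids-⊥ l)) (Bool.∧-identityʳ (distinct l))))
  count : ∀ B → G B ≡ true → ∑-arrangements ⊥ n (beforeIs B) ≡ precededCount n ∣ B ∣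
  count B GB rewrite countsBefore n ⊥ B (lookup-replicate a false) (G⇒a∉ B GB) (cong (_+ n) (∣⊥∣≡0 n)) | disjoint-⊥ʳ B =
    *-identityˡ _

rhs≡∑ : (F : Family n) (a : Fin n) (A : Subset n) →
        rhs F a A ≡ ∑[ B ∈ allSubsets n ] 𝟙 (ρ F a (A ⊕ B)) * precededCount n ∣ B ∣
rhs≡∑ {n} F a A = trans (∑-filter (inXorFamily A (ρ F a)) (allSubsets n) (λ B → precededCount n ∣ B ∣))
                        (∑-cong (allSubsets n) (λ B → cong (λ b → 𝟙 b * precededCount n ∣ B ∣) (inXorFamily-⊕ A (ρ F a) B)))

ρ-⊕-∌ : (F : Family n) (a : Fin n) (A B : Subset n) → lookup A a ≡ false → ρ F a (A ⊕ B) ≡ true → lookup B a ≡ false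
ρ-⊕-∌ F a A B a∉A ρ-true with lookup B a in a∈B?
... | false = refl
... | true rewrite lookup-⊕ A B a | a∉A | a∈B? = contradiction ρ-true λ ()

∉⇒lookup≡false : {a : Fin n} {A : Subset n} → a ∉ A → lookup A a ≡ false
∉⇒lookup≡false {a = a} {A} a∉A with lookup A a in a∈A?
... | false = refl
... | true = contradiction (lookup⇒[]= a A a∈A?) a∉A

open import Data.Integer using (+_)

mainTheorem5 : (n : ℕ) (F : Family n) → SubsetClosed F →
    (a : Fin n) (A : Subset n) → a ∉ A →
    Λ F A (A ∪ ⁅ a ⁆) ≡ + (rhs F a A)
mainTheorem5 n F closed a A a∉A = begin
  Λ F A (A ∪ ⁅ a ⁆)
    ≡⟨ cong (Λ F A) (sym (⊕⁅⁆≡∪⁅⁆ A a a∉A′)) ⟩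
  Λ F A (A ⊕ ⁅ a ⁆)
    ≡⟨ Λ-edge F closed a A a∉A′ ⟩
  pos (∑-permutations n (λ σ → 𝟙 (occurs a σ) * 𝟙 (ρ F a (A ⊕ before a σ))))
    ≡⟨ cong pos (∑-permutations-before a (λ B → ρ F a (A ⊕ B)) (λ B → ρ-⊕-∌ F a A B a∉A′)) ⟩
  pos (∑[ B ∈ allSubsets n ] 𝟙 (ρ F a (A ⊕ B)) * precededCount n ∣ B ∣)
    ≡⟨ cong pos (sym (rhs≡∑ F a A)) ⟩
  + rhs F a A ∎
  where
  open ≡-Reasoning
  a∉A′ : lookup A a ≡ false
  a∉A′ = ∉⇒lookup≡false a∉A
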